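{- Let $T$ be a hemi-Nelson algebra. Then every h-implicative filter of $T$ is an N-implicative filter of $T$.
   Context: A Kleene algebra is a bounded distributive lattice $\langle T,\wedge,\vee,0,1\rangle$ with a unary operation $\sim$ such that $\sim\sim x=x$, $\sim(x\wedge y)=\sim x\vee\sim y$ and $(x\wedge\sim x)\wedge(y\vee\sim y)=x\wedge\sim x$. A hemi-Nelson algebra is an algebra $\langle T,\wedge,\vee,\rightarrow,\sim,0,1\rangle$ of type $(2,2,2,1,0,0)$ such that $\langle T,\wedge,\vee,\sim,0,1\rangle$ is a Kleene algebra and for all $x,y,z\in T$: (hN1) $x\rightarrow x=1$; (hN2) $x\wedge(x\rightarrow y)\le x\wedge(\sim x\vee y)$; (hN3) $\sim(x\rightarrow y)\rightarrow(x\wedge\sim y)=1$; (hN4) $(x\wedge\sim y)\rightarrow\sim(x\rightarrow y)=1$; (hN5) $(x\wedge y\wedge(x\rightarrow y))\rightarrow(x\wedge(x\rightarrow y))=1$; (hN6) $(x\wedge(x\rightarrow y))\rightarrow(x\wedge y\wedge(x\rightarrow y))=1$; (hN7) if $x\rightarrow y=1$, $y\rightarrow x=1$, $y\rightarrow z=1$ and $z\rightarrow y=1$ then $x\rightarrow z=1$ and $z\rightarrow x=1$; (hN8) if $x\rightarrow y=1$ and $y\rightarrow x=1$ then $(x\wedge z)\rightarrow(y\wedge z)=1$; (hN9) if $x\rightarrow y=1$ and $y\rightarrow x=1$ then $(x\vee z)\rightarrow(y\vee z)=1$; (hN10) if $x\rightarrow y=1$ and $y\rightarrow x=1$ then $(x\rightarrow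 z)\rightarrow(y\rightarrow z)=1$ and $(z\rightarrow x)\rightarrow(z\rightarrow y)=1$. A subset $F\subseteq T$ is an implicative filter if $1\in F$ and for all $x,y\in T$, if $x\in F$ and $x\rightarrow y\in F$ then $y\in F$. An implicative filter $F$ is an h-implicative filter if for all $x,y\in T$ and $f\in F$: (F1) $(x\rightarrow y)\rightarrow((x\wedge f)\rightarrow(y\wedge f))\in F$; (F2) $((x\wedge f)\rightarrow(y\wedge f))\rightarrow(x\rightarrow y)\in F$; (F3) $\sim(x\rightarrow y)\rightarrow\sim((x\wedge f)\rightarrow(y\wedge f))\in F$; (F4) $\sim((x\wedge f)\rightarrow(y\wedge f))\rightarrow\sim(x\rightarrow y)\in F$. Let $x\rightarrow_N y$ denote $x\rightarrow(x\wedge y)$. A subset $F\subseteq T$ is an N-implicative filter if $1\in F$ and for all $x,y\in T$, if $x\in F$ and $x\rightarrow_N y\in F$ then $y\in F$. -}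

module Defs where

open import Level using (Level; _⊔_; suc)
open import Relation.Binary.PropositionalEquality using (_≡_)
open import Algebra.Lattice.Structures using (IsDistributiveLattice)
open import Relation.Unary using (Pred; _∈_)
open import Data.Product using (_×_)

record HemiNelsonAlgebra (a : Level) : Set (suc a) where
  infix 4 _≤_
  infixr 5 _⇒_
  infixr 6 _∨_
  infixr 7 _∧_
  field
    T    : Set a
    _∧_  : T → T → T
    _∨_  : T → T → T
    _⇒_  : T → T → T
    ∼    : T → T
    𝟘    : T
    𝟙    : T

  _≤_ : T → T → Set a
  x ≤ y = x ∧ y ≡ x

  field
    isDistributiveLattice : IsDistributiveLattice _≡_ _∨_ _∧_
    𝟘-min : ∀ x → 𝟘 ≤ x
    𝟙-max : ∀ x → x ≤ 𝟙
    ∼-invol  : ∀ x → ∼ (∼ x) ≡ x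
    ∼-∧      : ∀ x y → ∼ (x ∧ y) ≡ ∼ x ∨ ∼ y
    kleene   : ∀ x y → (x ∧ ∼ x) ∧ (y ∨ ∼ y) ≡ x ∧ ∼ x
    hN1 : ∀ x → x ⇒ x ≡ 𝟙
    hN2 : ∀ x y → x ∧ (x ⇒ y) ≤ x ∧ (∼ x ∨ y)
    hN3 : ∀ x y → ∼ (x ⇒ y) ⇒ (x ∧ ∼ y) ≡ 𝟙
    hN4 : ∀ x y → (x ∧ ∼ y) ⇒ ∼ (x ⇒ y) ≡ 𝟙
    hN5 : ∀ x y → (x ∧ y ∧ (x ⇒ y)) ⇒ (x ∧ (x ⇒ y)) ≡ 𝟙
    hN6 : ∀ x y → (x ∧ (x ⇒ y)) ⇒ (x ∧ y ∧ (x ⇒ y)) ≡ 𝟙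
    hN7 : ∀ x y z → x ⇒ y ≡ 𝟙 → y ⇒ x ≡ 𝟙 → y ⇒ z ≡ 𝟙 → z ⇒ y ≡ 𝟙 →
          (x ⇒ z ≡ 𝟙) × (z ⇒ x ≡ 𝟙)
    hN8 : ∀ x y z → x ⇒ y ≡ 𝟙 → y ⇒ x ≡ 𝟙 → (x ∧ z) ⇒ (y ∧ z) ≡ 𝟙
    hN9 : ∀ x y z → x ⇒ y ≡ 𝟙 → y ⇒ x ≡ 𝟙 → (x ∨ z) ⇒ (y ∨ z) ≡ 𝟙
    hN10 : ∀ x y z → x ⇒ y ≡ 𝟙 → y ⇒ x ≡ 𝟙 →
           ((x ⇒ z) ⇒ (y ⇒ z) ≡ 𝟙) × ((z ⇒ x) ⇒ (z ⇒ y) ≡ 𝟙)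

  _⇒N_ : T → T → T
  x ⇒N y = x ⇒ (x ∧ y)

  module _ {ℓ : Level} (F : Pred T ℓ) where

    IsImplicativeFilter : Set (a ⊔ ℓ)
    IsImplicativeFilter = (𝟙 ∈ F) × (∀ x y → x ∈ F → (x ⇒ y) ∈ F → y ∈ F)

    IsHImplicativeFilter : Set (a ⊔ ℓ)
    IsHImplicativeFilter =
      IsImplicativeFilter ×
      (∀ x y f → f ∈ F →
         (((x ⇒ y) ⇒ ((x ∧ f) ⇒ (y ∧ f))) ∈ F) ×
         ((((x ∧ f) ⇒ (y ∧ f)) ⇒ (x ⇒ y)) ∈ F) ×
         ((∼ (x ⇒ y) ⇒ ∼ ((x ∧ f) ⇒ (y ∧ f))) ∈ F) ×
         ((∼ ((x ∧ f) ⇒ (y ∧ f)) ⇒ ∼ (x ⇒ y)) ∈ F))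

    IsNImplicativeFilter : Set (a ⊔ ℓ)
    IsNImplicativeFilter = (𝟙 ∈ F) × (∀ x y → x ∈ F → (x ⇒N y) ∈ F → y ∈ F)

{-# OPTIONS --safe #-}
module Submission where

open import Defs
open import Level using (Level)
open import Relation.Unary using (Pred; _∈_)
open import Data.Product using (_,_; proj₁; proj₂)
open import Relation.Binary.PropositionalEquality using (_≡_; cong; cong₂; subst; trans; module ≡-Reasoning)
open import Algebra.Lattice.Bundles using (DistributiveLattice)
import Algebra.Lattice.Properties.DistributiveLattice as DistributiveLatticeProperties

-- Idea: an h-implicative filter F is upward closed, because for x ∈ F and x ≤ y,
-- condition (F2) with f = x gives ((x ∧ x) → (y ∧ x)) → (x → y) ∈ F, whose premise
-- is x → x = 1. Now x ∈ F and x →_N y ∈ F give x ∧ y ∈ F by modus ponens, hence y ∈ F.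

module _ {a : Level} (A : HemiNelsonAlgebra a) where
  open HemiNelsonAlgebra A

  distributiveLattice : DistributiveLattice a a
  distributiveLattice = record { isDistributiveLattice = isDistributiveLattice }

  open DistributiveLattice distributiveLattice using (∧-comm; ∧-assoc)
  open DistributiveLatticeProperties distributiveLattice using (∧-idem)

  x∧y≤y : ∀ x y → x ∧ y ≤ y
  x∧y≤y x y = begin
    (x ∧ y) ∧ y  ≡⟨ ∧-assoc x y y ⟩
    x ∧ (y ∧ y)  ≡⟨ cong (x ∧_) (∧-idem y) ⟩
    x ∧ y        ∎
    where open ≡-Reasoning

  x≤y⇒[x∧x]⇒[y∧x]≡𝟙 : ∀ {x y} → x ≤ y → (x ∧ x) ⇒ (y ∧ x) ≡ 𝟙
  x≤y⇒[x∧x]⇒[y∧x]≡𝟙 {x} {y} x≤y = begin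
    (x ∧ x) ⇒ (y ∧ x)  ≡⟨ cong₂ _⇒_ (∧-idem x) (trans (∧-comm y x) x≤y) ⟩
    x ⇒ x              ≡⟨ hN1 x ⟩
    𝟙                  ∎
    where open ≡-Reasoning

  module _ {ℓ : Level} {F : Pred T ℓ} where

    implicativeFilter-𝟙⇒ : IsImplicativeFilter F → ∀ {y} → (𝟙 ⇒ y) ∈ F → y ∈ F
    implicativeFilter-𝟙⇒ (𝟙∈F , mp) {y} = mp 𝟙 y 𝟙∈F

    hImplicativeFilter-⇒-of-≤ : IsHImplicativeFilter F → ∀ {x y} → x ∈ F → x ≤ y → (x ⇒ y) ∈ F
    hImplicativeFilter-⇒-of-≤ (isImplicative , restrict) {x} {y} x∈F x≤y =
      implicativeFilter-𝟙⇒ isImplicative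
        (subst (λ t → (t ⇒ (x ⇒ y)) ∈ F) (x≤y⇒[x∧x]⇒[y∧x]≡𝟙 x≤y)
          (proj₁ (proj₂ (restrict x y x x∈F))))

    hImplicativeFilter-upClosed : IsHImplicativeFilter F → ∀ {x y} → x ∈ F → x ≤ y → y ∈ F
    hImplicativeFilter-upClosed isH@((_ , mp) , _) {x} {y} x∈F x≤y =
      mp x y x∈F (hImplicativeFilter-⇒-of-≤ isH x∈F x≤y)

proposition31 : {a ℓ : Level} (A : HemiNelsonAlgebra a) (F : Pred (HemiNelsonAlgebra.T A) ℓ) →
    HemiNelsonAlgebra.IsHImplicativeFilter A F → HemiNelsonAlgebra.IsNImplicativeFilter A F
proposition31 A F isH@((𝟙∈F , mp) , _) = 𝟙∈F , N-modusPonens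
  where
  open HemiNelsonAlgebra A

  N-modusPonens : ∀ x y → x ∈ F → (x ⇒N y) ∈ F → y ∈ F
  N-modusPonens x y x∈F x⇒Ny∈F =
    hImplicativeFilter-upClosed A isH (mp x (x ∧ y) x∈F x⇒Ny∈F) (x∧y≤y A x y)
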